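{- Let $G$ be a $u$-uniform $k$-circle-layered hypergraph. Suppose there exists a $k$-hypercycle $v_0,\ldots,v_{k-1}$ in $G$ that does not use exactly one node from each part. Then $k \equiv 0 \pmod{u}$.
   Context: A $u$-uniform hypergraph is $k$-circle-layered (with $u\le k$) if its vertex set is partitioned into $V_1,\ldots,V_k$, arranged in a circle, and every hyperedge consists of exactly one vertex from each of $u$ cyclically consecutive parts $V_i, V_{i+1 \bmod k}, \ldots, V_{i+u-1 \bmod k}$. A (tight) $k$-hypercycle is a list of $k$ distinct nodes $v_0,\ldots,v_{k-1}$ such that for every $i$ the set $\{v_i, v_{i+1\bmod k}, \ldots, v_{i+u-1 \bmod k}\}$ is a hyperedge. -}

module Defs where

open import Data.Nat using (ℕ; zero; suc; _+_; _≤_; _%_; NonZero)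
open import Data.Nat.DivMod using (_mod_)
open import Data.Fin using (Fin; toℕ)
open import Data.Fin.Subset using (Subset; _∈_; ∣_∣)
open import Data.Product using (Σ; ∃; ∃-syntax; _×_; _,_)
open import Function.Definitions using (Injective)
open import Relation.Binary.PropositionalEquality using (_≡_)
open import Level using (0ℓ)

record UniformHypergraph (n u : ℕ) : Set₁ where
  field
    Edge    : Subset n → Set
    uniform : ∀ e → Edge e → ∣ e ∣ ≡ u

open UniformHypergraph public

_∈img_ : ∀ {n m} → Fin n → (Fin m → Fin n) → Set
x ∈img w = ∃[ j ] w j ≡ x

_+ₘ_ : ∀ {k} .{{_ : NonZero k}} → ℕ → ℕ → Fin k
_+ₘ_ {k} a b = (a + b) mod k

-- G is k-circle-layered w.r.t. the partition given by layer : Fin n → Fin k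
-- (part V_i = layer⁻¹(i)): every hyperedge consists of exactly one vertex
-- from each of u cyclically consecutive parts V_i, ..., V_{i+u-1 mod k}.
IsCircleLayered : ∀ {n u} (k : ℕ) .{{_ : NonZero k}} →
  UniformHypergraph n u → (Fin n → Fin k) → Set
IsCircleLayered {n} {u} k G layer =
  u ≤ k ×
  (∀ e → Edge G e →
     Σ (Fin k) λ i → Σ (Fin u → Fin n) λ w →
       Injective _≡_ _≡_ w ×
       (∀ x → (x ∈ e) → x ∈img w) ×
       (∀ j → w j ∈ e) ×
       (∀ j → layer (w j) ≡ toℕ i +ₘ toℕ j))

window : ∀ {n k} .{{_ : NonZero k}} (u : ℕ) → (Fin k → Fin n) → Fin k → Subset n → Set
window {n} {k} u v i e =
  (∀ x → x ∈ e → Σ (Fin u) λ j → v (toℕ i +ₘ toℕ j) ≡ x) ×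
  (∀ (j : Fin u) → v (toℕ i +ₘ toℕ j) ∈ e)

IsHypercycle : ∀ {n u} (k : ℕ) .{{_ : NonZero k}} →
  UniformHypergraph n u → (Fin k → Fin n) → Set
IsHypercycle {n} {u} k G v =
  Injective _≡_ _≡_ v ×
  (∀ i → Σ (Subset n) λ e → window u v i e × Edge G e)

OneFromEachPart : ∀ {n k} → (Fin n → Fin k) → (Fin k → Fin n) → Set
OneFromEachPart {n} {k} layer v =
  ∀ (i : Fin k) → Σ (Fin k) λ j → layer (v j) ≡ i × (∀ j' → layer (v j') ≡ i → j' ≡ j)

-- Read the layers of the cycle as a k-periodic sequence L of residues mod k. Every window
-- v_j, …, v_{j+u-1} is a hyperedge, so its layers form an arc of u consecutive residues.
-- Double counting (window, position) pairs gives u · #{p : L p = x} = Σ_{r<u} #{arcs ending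
-- at x + r}. If some residue x is never a layer, no arc ends at x, …, x + u - 1; cutting the
-- k residues from x on into k mod u residues there and ⌊k/u⌋ blocks of u consecutive ones,
-- every block carries a multiple of u arc ends, and there are k arcs, so u ∣ k. Otherwise
-- layer ∘ v : Fin k → Fin k is onto, hence bijective.
module Submission where

open import Defs
open import Data.Nat using (ℕ; NonZero; zero; suc; pred; _+_; _*_; _∸_; _/_; _%_; _<_; _≤_; s≤s; s≤s⁻¹)
open import Data.Nat.Properties
open import Algebra.Properties.CommutativeSemigroup +-commutativeSemigroup using (interchange)
open import Data.Nat.DivMod
  using (_mod_; m≡m%n+[m/n]*n; m%n<n; m%n%n≡m%n; %-distribˡ-+; [m+n]%n≡m%n; [m+kn]%n≡m%n; m<n⇒m%n≡m)
open import Data.Nat.Divisibility using (_∣_; _∣?_; divides; _∣0; ∣m∣n⇒∣m+n; n∣m⇒m%n≡0)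
open import Data.Fin using (Fin; toℕ; fromℕ<; punchOut)
open import Data.Fin.Properties
  using (toℕ-injective; toℕ-fromℕ<; toℕ<n; any?; injective⇒≤; punchOut-injective)
  renaming (_≟_ to _≟ᶠ_)
open import Data.Product using (∃; _×_; _,_; proj₁; proj₂)
open import Data.Sum using (inj₁; inj₂)
open import Function.Definitions using (Injective)
open import Relation.Nullary using (¬_; Dec; yes; no; contradiction)
open import Relation.Nullary.Decidable using (decidable-stable)
open import Relation.Binary.PropositionalEquality
  using (_≡_; refl; sym; trans; cong; cong₂; subst; module ≡-Reasoning)

∑< : ℕ → (ℕ → ℕ) → ℕ
∑< zero    f = 0
∑< (suc n) f = ∑< n f + f n

syntax ∑< n (λ i → e) = ∑[ i < n ] e

∑-cong : ∀ {n} {f g : ℕ → ℕ} → (∀ i → i < n → f i ≡ g i) → ∑[ i < n ] f i ≡ ∑[ i < n ] g i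
∑-cong {zero}  _  = refl
∑-cong {suc n} eq = cong₂ _+_ (∑-cong (λ i i<n → eq i (m<n⇒m<1+n i<n))) (eq n ≤-refl)

∑-zero : ∀ {n} {f : ℕ → ℕ} → (∀ i → i < n → f i ≡ 0) → ∑[ i < n ] f i ≡ 0
∑-zero {zero}  _  = refl
∑-zero {suc n} eq = cong₂ _+_ (∑-zero (λ i i<n → eq i (m<n⇒m<1+n i<n))) (eq n ≤-refl)

∑≡0⇒≡0 : ∀ {n} (f : ℕ → ℕ) → ∑[ i < n ] f i ≡ 0 → ∀ {i} → i < n → f i ≡ 0
∑≡0⇒≡0 {suc n} f eq i<1+n with m<1+n⇒m<n∨m≡n i<1+n
... | inj₁ i<n  = ∑≡0⇒≡0 f (m+n≡0⇒m≡0 _ eq) i<n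
... | inj₂ refl = m+n≡0⇒n≡0 (∑< n f) eq

∑-const : ∀ n c → ∑[ i < n ] c ≡ n * c
∑-const zero    c = refl
∑-const (suc n) c = trans (cong (_+ c) (∑-const n c)) (+-comm (n * c) c)

∑-distrib-+ : ∀ n (f g : ℕ → ℕ) → ∑[ i < n ] (f i + g i) ≡ ∑[ i < n ] f i + ∑[ i < n ] g i
∑-distrib-+ zero    f g = refl
∑-distrib-+ (suc n) f g =
  trans (cong (_+ (f n + g n)) (∑-distrib-+ n f g)) (interchange (∑< n f) (∑< n g) (f n) (g n))

∑-comm : ∀ m n (f : ℕ → ℕ → ℕ) → ∑[ i < m ] ∑[ j < n ] f i j ≡ ∑[ j < n ] ∑[ i < m ] f i j
∑-comm m zero    f = ∑-zero {m} (λ _ _ → refl)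
∑-comm m (suc n) f =
  trans (∑-distrib-+ m (λ i → ∑[ j < n ] f i j) (λ i → f i n)) (cong (_+ ∑[ i < m ] f i n) (∑-comm m n f))

∑-split : ∀ m n (f : ℕ → ℕ) → ∑[ i < m + n ] f i ≡ ∑[ i < m ] f i + ∑[ i < n ] f (m + i)
∑-split m zero    f = trans (cong (λ l → ∑< l f) (+-identityʳ m)) (sym (+-identityʳ (∑< m f)))
∑-split m (suc n) f = begin
  ∑[ i < m + suc n ] f i                               ≡⟨ cong (λ l → ∑< l f) (+-suc m n) ⟩
  ∑[ i < m + n ] f i + f (m + n)                       ≡⟨ cong (_+ f (m + n)) (∑-split m n f) ⟩
  ∑[ i < m ] f i + ∑[ i < n ] f (m + i) + f (m + n)    ≡⟨ +-assoc (∑< m f) _ _ ⟩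
  ∑[ i < m ] f i + ∑[ i < suc n ] f (m + i)            ∎
  where open ≡-Reasoning

∑-blocks : ∀ m u (f : ℕ → ℕ) → ∑[ i < m * u ] f i ≡ ∑[ q < m ] ∑[ r < u ] f (q * u + r)
∑-blocks zero    u f = refl
∑-blocks (suc m) u f = begin
  ∑[ i < u + m * u ] f i                               ≡⟨ cong (λ l → ∑< l f) (+-comm u (m * u)) ⟩
  ∑[ i < m * u + u ] f i                               ≡⟨ ∑-split (m * u) u f ⟩
  ∑[ i < m * u ] f i + ∑[ r < u ] f (m * u + r)        ≡⟨ cong (_+ ∑[ r < u ] f (m * u + r)) (∑-blocks m u f) ⟩
  ∑[ q < suc m ] ∑[ r < u ] f (q * u + r)              ∎
  where open ≡-Reasoning

∑-head : ∀ n (f : ℕ → ℕ) → ∑[ i < suc n ] f i ≡ f 0 + ∑[ i < n ] f (suc i)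
∑-head zero    f = +-comm 0 (f 0)
∑-head (suc n) f = trans (cong (_+ f (suc n)) (∑-head n f)) (+-assoc (f 0) _ _)

∑-rotate : ∀ n (f : ℕ → ℕ) → f n ≡ f 0 → ∑[ i < n ] f (suc i) ≡ ∑[ i < n ] f i
∑-rotate n f fn≡f0 = +-cancelˡ-≡ (f 0) _ _ (begin
  f 0 + ∑[ i < n ] f (suc i)  ≡⟨ ∑-head n f ⟨
  ∑[ i < n ] f i + f n        ≡⟨ cong (∑< n f +_) fn≡f0 ⟩
  ∑[ i < n ] f i + f 0        ≡⟨ +-comm (∑< n f) (f 0) ⟩
  f 0 + ∑[ i < n ] f i        ∎)
  where open ≡-Reasoning

∑-periodic : ∀ k (f : ℕ → ℕ) → (∀ p → f (p + k) ≡ f p) → ∀ z → ∑[ i < k ] f (i + z) ≡ ∑[ i < k ] f i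
∑-periodic k f periodic zero    = ∑-cong {k} (λ i _ → cong f (+-identityʳ i))
∑-periodic k f periodic (suc z) = begin
  ∑[ i < k ] f (i + suc z)    ≡⟨ ∑-cong {k} (λ i _ → cong f (+-suc i z)) ⟩
  ∑[ i < k ] f (suc i + z)    ≡⟨ ∑-rotate k (λ i → f (i + z)) (trans (cong f (+-comm k z)) (periodic z)) ⟩
  ∑[ i < k ] f (i + z)        ≡⟨ ∑-periodic k f periodic z ⟩
  ∑[ i < k ] f i              ∎
  where open ≡-Reasoning

∣-∑ : ∀ {d n} (f : ℕ → ℕ) → (∀ i → i < n → d ∣ f i) → d ∣ ∑[ i < n ] f i
∣-∑ {d} {zero}  f _   = d ∣0
∣-∑ {d} {suc n} f d∣f = ∣m∣n⇒∣m+n (∣-∑ f (λ i i<n → d∣f i (m<n⇒m<1+n i<n))) (d∣f n ≤-refl)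

[_] : {P : Set} → Dec P → ℕ
[ yes _ ] = 1
[ no  _ ] = 0

[]-yes : {P : Set} (P? : Dec P) → P → [ P? ] ≡ 1
[]-yes (yes _) _ = refl
[]-yes (no ¬p) p = contradiction p ¬p

[]-no : {P : Set} (P? : Dec P) → ¬ P → [ P? ] ≡ 0
[]-no (yes p) ¬p = contradiction p ¬p
[]-no (no _)  _  = refl

[]-cong : {P Q : Set} (P? : Dec P) (Q? : Dec Q) → (P → Q) → (Q → P) → [ P? ] ≡ [ Q? ]
[]-cong (yes p) Q? P⇒Q _ = sym ([]-yes Q? (P⇒Q p))
[]-cong (no ¬p) Q? _ Q⇒P = sym ([]-no Q? (λ q → ¬p (Q⇒P q)))

module _ {P : ℕ → Set} (P? : ∀ i → Dec (P i)) where

  ∑-[]-none : ∀ {n} → (∀ i → i < n → ¬ P i) → ∑[ i < n ] [ P? i ] ≡ 0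
  ∑-[]-none none = ∑-zero (λ i i<n → []-no (P? i) (none i i<n))

  ∑-[]-unique : ∀ {n i} → i < n → P i → (∀ j → j < n → P j → j ≡ i) → ∑[ j < n ] [ P? j ] ≡ 1
  ∑-[]-unique {suc n} {i} i<1+n p unique with m<1+n⇒m<n∨m≡n i<1+n
  ... | inj₁ i<n  = cong₂ _+_ (∑-[]-unique i<n p (λ j j<n → unique j (m<n⇒m<1+n j<n)))
                              ([]-no (P? n) (λ pn → <-irrefl (sym (unique n ≤-refl pn)) i<n))
  ... | inj₂ refl = cong₂ _+_ (∑-[]-none (λ j j<n pj → <-irrefl (unique j (m<n⇒m<1+n j<n) pj) j<n))
                              ([]-yes (P? n) p)

∑-[]-at-most-once : ∀ {P Q : ℕ → Set} (P? : ∀ i → Dec (P i)) (Q? : ∀ j → Dec (Q j)) {m n} →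
  (∀ {i i'} → i < m → i' < m → P i → P i' → i ≡ i') →
  (∀ {j j'} → j < n → j' < n → Q j → Q j' → j ≡ j') →
  (∃ (λ i → i < m × P i) → ∃ (λ j → j < n × Q j)) →
  (∃ (λ j → j < n × Q j) → ∃ (λ i → i < m × P i)) →
  ∑[ i < m ] [ P? i ] ≡ ∑[ j < n ] [ Q? j ]
∑-[]-at-most-once P? Q? {m} {n} P-once Q-once P⇒Q Q⇒P with anyUpTo? P? m
... | yes (i , i<m , p) = let (j , j<n , q) = P⇒Q (i , i<m , p) in
  trans (∑-[]-unique P? i<m p (λ i' i'<m p' → P-once i'<m i<m p' p))
        (sym (∑-[]-unique Q? j<n q (λ j' j'<n q' → Q-once j'<n j<n q' q)))
... | no ¬∃P =
  trans (∑-[]-none P? (λ i i<m p → ¬∃P (i , i<m , p)))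
        (sym (∑-[]-none Q? (λ j j<n q → ¬∃P (Q⇒P (j , j<n , q)))))

module Modulo (k : ℕ) .{{_ : NonZero k}} where

  infix 4 _≡ₘ_ _≟ₘ_

  _≡ₘ_ : ℕ → ℕ → Set
  a ≡ₘ b = a % k ≡ b % k

  _≟ₘ_ : ∀ a b → Dec (a ≡ₘ b)
  a ≟ₘ b = a % k ≟ b % k

  ≡ₘ⇒≡ : ∀ {a b} → a < k → b < k → a ≡ₘ b → a ≡ b
  ≡ₘ⇒≡ a<k b<k eq = trans (sym (m<n⇒m%n≡m a<k)) (trans eq (m<n⇒m%n≡m b<k))

  +-congʳ-≡ₘ : ∀ {a b} c → a ≡ₘ b → a + c ≡ₘ b + c
  +-congʳ-≡ₘ {a} {b} c eq = begin
    (a + c) % k          ≡⟨ %-distribˡ-+ a c k ⟩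
    (a % k + c % k) % k  ≡⟨ cong (λ x → (x + c % k) % k) eq ⟩
    (b % k + c % k) % k  ≡⟨ %-distribˡ-+ b c k ⟨
    (b + c) % k          ∎
    where open ≡-Reasoning

  -- Adding c * pred k turns the summand c into the multiple c * k.
  +-cancelʳ-≡ₘ : ∀ {a b} c → a + c ≡ₘ b + c → a ≡ₘ b
  +-cancelʳ-≡ₘ {a} {b} c eq = begin
    a % k                     ≡⟨ [m+kn]%n≡m%n a c k ⟨
    (a + c * k) % k           ≡⟨ cong (_% k) (complete a) ⟩
    (a + c + c * pred k) % k  ≡⟨ +-congʳ-≡ₘ (c * pred k) eq ⟩
    (b + c + c * pred k) % k  ≡⟨ cong (_% k) (complete b) ⟨
    (b + c * k) % k           ≡⟨ [m+kn]%n≡m%n b c k ⟩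
    b % k                     ∎
    where
    open ≡-Reasoning
    complete : ∀ x → x + c * k ≡ x + c + c * pred k
    complete x = begin
      x + c * k             ≡⟨ cong (λ y → x + c * y) (suc-pred k) ⟨
      x + c * suc (pred k)  ≡⟨ cong (x +_) (*-suc c (pred k)) ⟩
      x + (c + c * pred k)  ≡⟨ +-assoc x c _ ⟨
      x + c + c * pred k    ∎

  +-cancelˡ-≡ₘ : ∀ c {r r'} → r < k → r' < k → c + r ≡ₘ c + r' → r ≡ r'
  +-cancelˡ-≡ₘ c {r} {r'} r<k r'<k eq = ≡ₘ⇒≡ r<k r'<k
    (+-cancelʳ-≡ₘ c (trans (cong (_% k) (+-comm r c)) (trans eq (cong (_% k) (+-comm c r')))))

  []-congˡ-≡ₘ : ∀ {a a'} b → a ≡ₘ a' → [ a ≟ₘ b ] ≡ [ a' ≟ₘ b ]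
  []-congˡ-≡ₘ b eq = []-cong (_ ≟ₘ b) (_ ≟ₘ b) (trans (sym eq)) (trans eq)

  ∑-residues : ∀ z a → ∑[ i < k ] [ z + i ≟ₘ a ] ≡ 1
  ∑-residues z a = begin
    ∑[ i < k ] [ z + i ≟ₘ a ]  ≡⟨ ∑-cong {k} (λ i _ → cong (λ y → [ y ≟ₘ a ]) (+-comm z i)) ⟩
    ∑[ i < k ] [ i + z ≟ₘ a ]  ≡⟨ ∑-periodic k (λ i → [ i ≟ₘ a ]) (λ p → []-congˡ-≡ₘ a ([m+n]%n≡m%n p k)) z ⟩
    ∑[ i < k ] [ i ≟ₘ a ]      ≡⟨ ∑-[]-unique (_≟ₘ a) a%k<k (m%n%n≡m%n a k) only-a%k ⟩
    1                          ∎
    where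
    open ≡-Reasoning
    a%k<k : a % k < k
    a%k<k = m%n<n a k
    only-a%k : ∀ i → i < k → i ≡ₘ a → i ≡ a % k
    only-a%k i i<k i≡a = ≡ₘ⇒≡ i<k a%k<k (trans i≡a (sym (m%n%n≡m%n a k)))

  toℕ-mod : ∀ a → toℕ (a mod k) ≡ a % k
  toℕ-mod a = toℕ-fromℕ< (m%n<n a k)

  mod-cong : ∀ {a b} → a ≡ₘ b → a mod k ≡ b mod k
  mod-cong {a} {b} eq = toℕ-injective (trans (toℕ-mod a) (trans eq (sym (toℕ-mod b))))

  mod-injective : ∀ {a b} → a mod k ≡ b mod k → a ≡ₘ b
  mod-injective {a} {b} eq = trans (sym (toℕ-mod a)) (trans (cong toℕ eq) (toℕ-mod b))

module _ {k : ℕ} .{{_ : NonZero k}} where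
  open Modulo k

  -- The window L j, …, L (j + u - 1) is the arc e - u + 1, …, e of ℤ/k, without repetitions.
  record IsArcWindow (u : ℕ) (L : ℕ → ℕ) (j e : ℕ) : Set where
    field
      ⊆arc     : ∀ {t} → t < u → ∃ λ r → r < u × L (j + t) + r ≡ₘ e
      ⊇arc     : ∀ {r} → r < u → ∃ λ t → t < u × L (j + t) + r ≡ₘ e
      distinct : ∀ {t t'} → t < u → t' < u → L (j + t) ≡ₘ L (j + t') → t ≡ t'

  module ArcWindows {u : ℕ} .{{_ : NonZero u}} (u≤k : u ≤ k)
    (L : ℕ → ℕ) (L-periodic : ∀ p → L (p + k) ≡ₘ L p) (arcs : ∀ j → ∃ (IsArcWindow u L j)) where

    end : ℕ → ℕ
    end j = proj₁ (arcs j)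

    occurrences : ℕ → ℕ
    occurrences x = ∑[ p < k ] [ L p ≟ₘ x ]

    arcsEndingAt : ℕ → ℕ
    arcsEndingAt y = ∑[ j < k ] [ y ≟ₘ end j ]

    window-occurrences : ∀ j x → ∑[ t < u ] [ L (j + t) ≟ₘ x ] ≡ ∑[ r < u ] [ x + r ≟ₘ end j ]
    window-occurrences j x = ∑-[]-at-most-once (λ t → L (j + t) ≟ₘ x) (λ r → x + r ≟ₘ end j)
      (λ t<u t'<u t≡x t'≡x → distinct t<u t'<u (trans t≡x (sym t'≡x)))
      (λ r<u r'<u r≡e r'≡e → +-cancelˡ-≡ₘ x (<-≤-trans r<u u≤k) (<-≤-trans r'<u u≤k) (trans r≡e (sym r'≡e)))
      (λ (t , t<u , t≡x) → let (r , r<u , t+r≡e) = ⊆arc t<u in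
                           r , r<u , trans (sym (+-congʳ-≡ₘ r t≡x)) t+r≡e)
      (λ (r , r<u , x+r≡e) → let (t , t<u , t+r≡e) = ⊇arc r<u in
                             t , t<u , +-cancelʳ-≡ₘ r (trans t+r≡e (sym x+r≡e)))
      where open IsArcWindow (proj₂ (arcs j))

    u*occurrences : ∀ x → u * occurrences x ≡ ∑[ r < u ] arcsEndingAt (x + r)
    u*occurrences x = begin
      u * occurrences x                         ≡⟨ ∑-const u (occurrences x) ⟨
      ∑[ t < u ] occurrences x                  ≡⟨ ∑-cong {u} (λ t _ → shift t) ⟨
      ∑[ t < u ] ∑[ j < k ] [ L (j + t) ≟ₘ x ]  ≡⟨ ∑-comm u k _ ⟩
      ∑[ j < k ] ∑[ t < u ] [ L (j + t) ≟ₘ x ]  ≡⟨ ∑-cong {k} (λ j _ → window-occurrences j x) ⟩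
      ∑[ j < k ] ∑[ r < u ] [ x + r ≟ₘ end j ]  ≡⟨ ∑-comm k u _ ⟩
      ∑[ r < u ] arcsEndingAt (x + r)           ∎
      where
      open ≡-Reasoning
      shift : ∀ t → ∑[ j < k ] [ L (j + t) ≟ₘ x ] ≡ occurrences x
      shift = ∑-periodic k (λ p → [ L p ≟ₘ x ]) (λ p → []-congˡ-≡ₘ x (L-periodic p))

    ∑-arcsEndingAt : ∀ z → ∑[ i < k ] arcsEndingAt (z + i) ≡ k
    ∑-arcsEndingAt z = begin
      ∑[ i < k ] ∑[ j < k ] [ z + i ≟ₘ end j ]  ≡⟨ ∑-comm k k _ ⟩
      ∑[ j < k ] ∑[ i < k ] [ z + i ≟ₘ end j ]  ≡⟨ ∑-cong {k} (λ j _ → ∑-residues z (end j)) ⟩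
      ∑[ j < k ] 1                              ≡⟨ ∑-const k 1 ⟩
      k * 1                                     ≡⟨ *-identityʳ k ⟩
      k                                         ∎
      where open ≡-Reasoning

    missed⇒∣ : ∀ x → (∀ p → ¬ L p ≡ₘ x) → u ∣ k
    missed⇒∣ x missed = subst (u ∣_) (sym k≡blocks) (∣-∑ {n = m} _ (λ q _ → block (x + ρ + q * u)))
      where
      open ≡-Reasoning
      ρ = k % u
      m = k / u

      noEndNear : ∀ {r} → r < u → arcsEndingAt (x + r) ≡ 0
      noEndNear = ∑≡0⇒≡0 (λ r → arcsEndingAt (x + r)) (begin
        ∑[ r < u ] arcsEndingAt (x + r)  ≡⟨ u*occurrences x ⟨
        u * occurrences x                ≡⟨ cong (u *_) (∑-[]-none (λ p → L p ≟ₘ x) {k} (λ p _ → missed p)) ⟩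
        u * 0                            ≡⟨ *-zeroʳ u ⟩
        0                                ∎)

      block : ∀ y → u ∣ ∑[ r < u ] arcsEndingAt (y + r)
      block y = divides (occurrences y) (trans (sym (u*occurrences y)) (*-comm u _))

      k≡blocks : k ≡ ∑[ q < m ] ∑[ r < u ] arcsEndingAt (x + ρ + q * u + r)
      k≡blocks = begin
        k                                                  ≡⟨ ∑-arcsEndingAt x ⟨
        ∑[ i < k ] arcsEndingAt (x + i)                    ≡⟨ cong (λ l → ∑< l (λ i → arcsEndingAt (x + i)))
                                                                   (m≡m%n+[m/n]*n k u) ⟩
        ∑[ i < ρ + m * u ] arcsEndingAt (x + i)            ≡⟨ ∑-split ρ (m * u) _ ⟩
        ∑[ i < ρ ] arcsEndingAt (x + i)
          + ∑[ i < m * u ] arcsEndingAt (x + (ρ + i))      ≡⟨ cong₂ _+_ nothingBeforeBlocks (∑-blocks m u _) ⟩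
        ∑[ q < m ] ∑[ r < u ] arcsEndingAt (x + (ρ + (q * u + r)))
                                                           ≡⟨ ∑-cong {m} (λ q _ → ∑-cong {u} (λ r _ →
                                                                cong arcsEndingAt (reassoc q r))) ⟩
        ∑[ q < m ] ∑[ r < u ] arcsEndingAt (x + ρ + q * u + r)  ∎
        where
        nothingBeforeBlocks : ∑[ i < ρ ] arcsEndingAt (x + i) ≡ 0
        nothingBeforeBlocks = ∑-zero (λ i i<ρ → noEndNear (<-trans i<ρ (m%n<n k u)))
        reassoc : ∀ q r → x + (ρ + (q * u + r)) ≡ x + ρ + q * u + r
        reassoc q r = trans (sym (+-assoc x ρ _)) (sym (+-assoc (x + ρ) (q * u) r))

injective⇒surjective : ∀ {m} (f : Fin m → Fin m) → Injective _≡_ _≡_ f → ∀ y → ∃ λ x → f x ≡ y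
injective⇒surjective {suc m} f f-injective y with any? (λ x → f x ≟ᶠ y)
... | yes hit  = hit
... | no  miss = contradiction (injective⇒≤ avoid-y-injective) 1+n≰n
  where
  y≢f : ∀ x → ¬ y ≡ f x
  y≢f x y≡fx = miss (x , sym y≡fx)
  avoid-y : Fin (suc m) → Fin m
  avoid-y x = punchOut (y≢f x)
  avoid-y-injective : Injective _≡_ _≡_ avoid-y
  avoid-y-injective eq = f-injective (punchOut-injective (y≢f _) (y≢f _) eq)

surjective⇒injective : ∀ {m} (f : Fin m → Fin m) → (∀ y → ∃ λ x → f x ≡ y) → Injective _≡_ _≡_ f
surjective⇒injective f surjective {x} {x'} fx≡fx' =
  trans (sym (gf≡id x)) (trans (cong g fx≡fx') (gf≡id x'))
  where
  g : _ → _
  g y = proj₁ (surjective y)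

  fg≡id : ∀ y → f (g y) ≡ y
  fg≡id y = proj₂ (surjective y)

  g-injective : Injective _≡_ _≡_ g
  g-injective {y} {y'} eq = trans (sym (fg≡id y)) (trans (cong f eq) (fg≡id y'))

  gf≡id : ∀ x → g (f x) ≡ x
  gf≡id x = let (y , gy≡x) = injective⇒surjective g g-injective x in
    trans (cong (λ z → g (f z)) (sym gy≡x)) (trans (cong g (fg≡id y)) gy≡x)

surjective⇒oneFromEachPart : ∀ {n k} (layer : Fin n → Fin k) (v : Fin k → Fin n) →
  (∀ i → ∃ λ j → layer (v j) ≡ i) → OneFromEachPart layer v
surjective⇒oneFromEachPart layer v surjective i =
  let (j , hit) = surjective i in
  j , hit , λ j' hit' → surjective⇒injective (λ j → layer (v j)) surjective (trans hit' (sym hit))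

module _ {n u' k : ℕ} .{{_ : NonZero k}} (G : UniformHypergraph n (suc u')) (layer : Fin n → Fin k)
  (circleLayered : IsCircleLayered k G layer) (v : Fin k → Fin n) (hypercycle : IsHypercycle k G v) where
  open Modulo k

  u≤k : suc u' ≤ k
  u≤k = proj₁ circleLayered

  vertexAt : ℕ → Fin n
  vertexAt p = v (p mod k)

  layerAt : ℕ → ℕ
  layerAt p = toℕ (layer (vertexAt p))

  layerAt-periodic : ∀ p → layerAt (p + k) ≡ₘ layerAt p
  layerAt-periodic p = cong (λ q → toℕ (layer (v q)) % k) (mod-cong ([m+n]%n≡m%n p k))

  -- The hyperedge of window j lists its vertices as w 0, …, w u' with layers s, …, s + u',
  -- so its arc ends at s + u'.
  windowIsArc : ∀ j → ∃ (IsArcWindow (suc u') layerAt j)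
  windowIsArc j with proj₂ hypercycle (j mod k)
  ... | E , (E⊆window , window⊆E) , isEdge with proj₂ circleLayered E isEdge
  ... | s , w , _ , E⊆w , w⊆E , w-layer = toℕ s + u' , record
    { ⊆arc     = ⊆arc
    ; ⊇arc     = ⊇arc
    ; distinct = distinct
    }
    where
    windowVertex : ∀ a → v (toℕ (j mod k) +ₘ a) ≡ vertexAt (j + a)
    windowVertex a = cong v (mod-cong (+-congʳ-≡ₘ a (trans (cong (_% k) (toℕ-mod j)) (m%n%n≡m%n j k))))

    listed : ∀ {t} → t < suc u' → ∃ λ r → vertexAt (j + t) ≡ w r
    listed {t} t<u =
      let (r , wr≡vt) = E⊆w _ (window⊆E (fromℕ< t<u)) in
      r , sym (trans wr≡vt (trans (windowVertex _) (cong (λ a → vertexAt (j + a)) (toℕ-fromℕ< t<u))))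

    position : ∀ r → ∃ λ t → t < suc u' × vertexAt (j + t) ≡ w r
    position r =
      let (t , vt≡wr) = E⊆window _ (w⊆E r) in
      toℕ t , toℕ<n t , trans (sym (windowVertex (toℕ t))) vt≡wr

    layerOfListed : ∀ {p} r → vertexAt p ≡ w r → layerAt p ≡ₘ toℕ s + toℕ r
    layerOfListed {p} r vp≡wr = begin
      layerAt p % k             ≡⟨ cong (λ y → toℕ (layer y) % k) vp≡wr ⟩
      toℕ (layer (w r)) % k     ≡⟨ cong (λ y → toℕ y % k) (w-layer r) ⟩
      toℕ (toℕ s +ₘ toℕ r) % k  ≡⟨ cong (_% k) (toℕ-mod _) ⟩
      (toℕ s + toℕ r) % k % k   ≡⟨ m%n%n≡m%n _ k ⟩
      (toℕ s + toℕ r) % k       ∎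
      where open ≡-Reasoning

    shiftToEnd : ∀ {a} r q → r + q ≡ u' → a ≡ₘ toℕ s + r → a + q ≡ₘ toℕ s + u'
    shiftToEnd r q r+q≡u' eq =
      trans (+-congʳ-≡ₘ q eq) (cong (_% k) (trans (+-assoc (toℕ s) r q) (cong (toℕ s +_) r+q≡u')))

    ⊆arc : ∀ {t} → t < suc u' → ∃ λ r → r < suc u' × layerAt (j + t) + r ≡ₘ toℕ s + u'
    ⊆arc t<u =
      let (r , vt≡wr) = listed t<u in
      u' ∸ toℕ r , s≤s (m∸n≤m u' (toℕ r)) ,
      shiftToEnd (toℕ r) (u' ∸ toℕ r) (m+[n∸m]≡n (s≤s⁻¹ (toℕ<n r))) (layerOfListed r vt≡wr)

    ⊇arc : ∀ {r} → r < suc u' → ∃ λ t → t < suc u' × layerAt (j + t) + r ≡ₘ toℕ s + u'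
    ⊇arc {r} r<u =
      let (t , t<u , vt≡wr̂) = position r̂ in
      t , t<u , shiftToEnd (toℕ r̂) r r̂+r≡u' (layerOfListed r̂ vt≡wr̂)
      where
      r̂ : Fin (suc u')
      r̂ = fromℕ< (s≤s (m∸n≤m u' r))
      r̂+r≡u' : toℕ r̂ + r ≡ u'
      r̂+r≡u' = trans (cong (_+ r) (toℕ-fromℕ< _)) (m∸n+n≡m (s≤s⁻¹ r<u))

    distinct : ∀ {t t'} → t < suc u' → t' < suc u' → layerAt (j + t) ≡ₘ layerAt (j + t') → t ≡ t'
    distinct {t} {t'} t<u t'<u eq with listed t<u | listed t'<u
    ... | r , vt≡wr | r' , vt'≡wr' =
      +-cancelˡ-≡ₘ j (<-≤-trans t<u u≤k) (<-≤-trans t'<u u≤k) (mod-injective (proj₁ hypercycle sameVertex))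
      where
      r≡r' : r ≡ r'
      r≡r' = toℕ-injective (+-cancelˡ-≡ₘ (toℕ s) (<-≤-trans (toℕ<n r) u≤k) (<-≤-trans (toℕ<n r') u≤k)
               (trans (sym (layerOfListed r vt≡wr)) (trans eq (layerOfListed r' vt'≡wr'))))
      sameVertex : vertexAt (j + t) ≡ vertexAt (j + t')
      sameVertex = trans vt≡wr (trans (cong w r≡r') (sym vt'≡wr'))

  ∤⇒everyPartVisited : ¬ suc u' ∣ k → ∀ y → ∃ λ p → layer (v p) ≡ y
  ∤⇒everyPartVisited u∤k y with any? (λ p → layer (v p) ≟ᶠ y)
  ... | yes visited = visited
  ... | no  missed  =
    contradiction (ArcWindows.missed⇒∣ u≤k layerAt layerAt-periodic windowIsArc (toℕ y) never) u∤k
    where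
    never : ∀ p → ¬ layerAt p ≡ₘ toℕ y
    never p eq = missed (p mod k , toℕ-injective (≡ₘ⇒≡ (toℕ<n _) (toℕ<n y) eq))

mainTheorem9 : (n u k : ℕ) .{{_ : NonZero k}} .{{_ : NonZero u}}
    (G : UniformHypergraph n u) (layer : Fin n → Fin k) →
    IsCircleLayered k G layer →
    (v : Fin k → Fin n) → IsHypercycle k G v →
    ¬ OneFromEachPart layer v →
    k % u ≡ 0
mainTheorem9 n zero     k ⦃ _ ⦄ ⦃ () ⦄
mainTheorem9 n (suc u') k G layer circleLayered v hypercycle notOneFromEach =
  n∣m⇒m%n≡0 k (suc u') (decidable-stable (suc u' ∣? k) λ u∤k →
    notOneFromEach (surjective⇒oneFromEachPart layer v
      (∤⇒everyPartVisited G layer circleLayered v hypercycle u∤k)))
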